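{- Let $T\subseteq X_0$ be a generalised nice set with $\langle P_{\{1,2,1\}}\rangle\subseteq T$. Then there is a collineation $\sigma$ with $\tilde\sigma(\langle P_{\{1,2,1\}}\rangle)=\langle P_{\{1,2,1\}}\rangle$ such that $\tilde\sigma(T\cap X)$ equals one of the following: $\{\{1,2\},\{1,5\}\}$; $X_{\ell_{12}}=\{\{1,2\},\{1,5\},\{2,5\}\}$; $\{\{1,2\},\{1,3\},\{1,5\},\{1,6\}\}$; $X_{(1)}=\{\{1,l\}:l=2,\dots,7\}$; $T_{(1,2,3)}$; $T_{(1,3,4)}$; $X\setminus X_{\ell_{12}^C}$; $X\setminus X_{\ell_{13}^C}$; $X$.
   Context: Let $I=\{1,\dots,7\}$ and $I_0=I\cup\{0\}$. The Fano plane on $I$ has the seven lines $\{1,2,5\},\{5,6,7\},\{1,4,7\},\{1,3,6\},\{2,4,6\},\{2,3,7\},\{3,4,5\}$. For distinct $i,j\in I$, $i*j$ is the third point of the unique line containing $i$ and $j$, and $\ell_{ij}=\{i,j,i*j\}$. The operation is extended to $I_0$ by $0*i=i*0=i$ and $i*i=0$ for all $i\in I_0$. Three pairwise distinct $i,j,k\in I$ are generative if $k\neq i*j$. A collineation is a bijection $\sigma:I_0\to I_0$ with $\sigma(i*j)=\sigma(i)*\sigma(j)$ for all $i,j\in I_0$; it acts on unordered pairs by $\tilde\sigma(\{i,j\})=\{\sigma(i),\sigma(j)\}$ and hence on sets of pairs. Let $X_0$ be the set of unordered pairs $\{i,j\}$ with $i,j\in I_0$, where $i=j$ is allowed, and $X=\{\{i,j\}:i,j\in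 I,\ i\neq j\}$. For a line $\ell$, $X_\ell=\{\{i,j\}\in X:i,j\in\ell\}$ and $X_{\ell^C}=\{\{i,j\}\in X:i,j\notin\ell\}$; $X_{(1)}=\{\{1,j\}\in X\}$. For $i,j,k\in I_0$ let $P_{\{i,j,k\}}=\{\{i,j\},\{j,k\},\{k,i\},\{i,j*k\},\{j,k*i\},\{k,i*j\}\}\subseteq X_0$. For generative $i,j,k\in I$, $T_{(i,j,k)}=P_{\{i,j,k\}}\cup\{\{i,i*j\},\{i,i*k\},\{i*j,i*k\},\{i,i*j*k\}\}$. A subset $T\subseteq X_0$ is a generalised nice set if for all $i,j,k\in I_0$, $\{i,j\}\in T$ and $\{i*j,k\}\in T$ imply $P_{\{i,j,k\}}\subseteq T$. For $S\subseteq X_0$, $\langle S\rangle$ denotes the smallest generalised nice set containing $S$. -}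

module Defs where

open import Data.Bool using (Bool; true; false; _∨_)
open import Data.Fin using (Fin; #_; _≟_)
open import Data.List using (List; []; _∷_)
open import Data.List.Membership.Propositional using (_∈_)
open import Data.List.Relation.Unary.All using (All)
open import Data.Maybe using (Maybe; just; nothing)
open import Data.Product using (_×_; _,_; ∃; ∃-syntax; Σ)
open import Data.Sum using (_⊎_)
open import Function.Definitions using (Bijective)
open import Relation.Binary.PropositionalEquality using (_≡_; _≢_)
open import Relation.Nullary using (¬_; yes; no)

-- I₀ = {0,…,7}; I = I₀ ∖ {0}
I₀ : Set
I₀ = Fin 8

record Triple : Set where
  constructor tri
  field a b c : I₀

fanoLines : List Triple
fanoLines =
  tri (# 1) (# 2) (# 5) ∷ tri (# 5) (# 6) (# 7) ∷ tri (# 1) (# 4) (# 7) ∷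
  tri (# 1) (# 3) (# 6) ∷ tri (# 2) (# 4) (# 6) ∷ tri (# 2) (# 3) (# 7) ∷
  tri (# 3) (# 4) (# 5) ∷ []

thirdOn : Triple → I₀ → I₀ → Maybe I₀
thirdOn (tri a b c) i j with i ≟ a | j ≟ b | i ≟ b | j ≟ a
... | yes _ | yes _ | _ | _ = just c
... | _ | _ | yes _ | yes _ = just c
... | _ | _ | _ | _ with i ≟ a | j ≟ c | i ≟ c | j ≟ a
...   | yes _ | yes _ | _ | _ = just b
...   | _ | _ | yes _ | yes _ = just b
...   | _ | _ | _ | _ with i ≟ b | j ≟ c | i ≟ c | j ≟ b
...     | yes _ | yes _ | _ | _ = just a
...     | _ | _ | yes _ | yes _ = just a
...     | _ | _ | _ | _ = nothing

thirdPt : List Triple → I₀ → I₀ → I₀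
thirdPt [] i j = # 0
thirdPt (ℓ ∷ ls) i j with thirdOn ℓ i j
... | just k = k
... | nothing = thirdPt ls i j

infixl 7 _*_
_*_ : I₀ → I₀ → I₀
i * j with i ≟ j
... | yes _ = # 0
... | no _ with i ≟ # 0
...   | yes _ = j
...   | no _ with j ≟ # 0
...     | yes _ = i
...     | no _ = thirdPt fanoLines i j

-- Sets of unordered pairs {i,j} (i = j allowed), i.e. subsets of X₀,
-- are represented by relations R; {i,j} ∈ R means R i j ⊎ R j i.
Rel₂ : Set₁
Rel₂ = I₀ → I₀ → Set

_∋₂_,_ : Rel₂ → I₀ → I₀ → Set
R ∋₂ i , j = R i j ⊎ R j i

fromList : List (I₀ × I₀) → Rel₂
fromList l i j = (i , j) ∈ l

boolSet : (I₀ → I₀ → Bool) → Rel₂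
boolSet T i j = T i j ≡ true

_≐_ : Rel₂ → Rel₂ → Set
A ≐ B = ∀ i j → ((A ∋₂ i , j) → (B ∋₂ i , j)) × ((B ∋₂ i , j) → (A ∋₂ i , j))

_⊆₂_ : Rel₂ → Rel₂ → Set
A ⊆₂ B = ∀ i j → (A ∋₂ i , j) → (B ∋₂ i , j)

_∩₂_ : Rel₂ → Rel₂ → Rel₂
(A ∩₂ B) i j = (A ∋₂ i , j) × (B ∋₂ i , j)

XSet : Rel₂
XSet i j = (i ≢ # 0) × (j ≢ # 0) × (i ≢ j)

P : I₀ → I₀ → I₀ → List (I₀ × I₀)
P i j k = (i , j) ∷ (j , k) ∷ (k , i) ∷ (i , j * k) ∷ (j , k * i) ∷ (k , i * j) ∷ []

Nice : Rel₂ → Set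
Nice R = ∀ i j k → (R ∋₂ i , j) → (R ∋₂ (i * j) , k) →
         All (λ p → R ∋₂ Data.Product.proj₁ p , Data.Product.proj₂ p) (P i j k)

data Gen (S : Rel₂) : Rel₂ where
  base : ∀ {i j} → S ∋₂ i , j → Gen S i j
  swap : ∀ {i j} → Gen S i j → Gen S j i
  close : ∀ {i j k a b} → Gen S i j → Gen S (i * j) k → (a , b) ∈ P i j k → Gen S a b

lineOf : I₀ → I₀ → List I₀
lineOf i j = i ∷ j ∷ i * j ∷ []

Xin : List I₀ → Rel₂
Xin ℓ i j = XSet i j × i ∈ ℓ × j ∈ ℓ

XminusXC : List I₀ → Rel₂
XminusXC ℓ i j = XSet i j × ¬ ((¬ i ∈ ℓ) × (¬ j ∈ ℓ))

X₁ : Rel₂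
X₁ i j = XSet i j × i ≡ # 1

Tgen : I₀ → I₀ → I₀ → List (I₀ × I₀)
Tgen i j k = (i , i * j) ∷ (i , i * k) ∷ (i * j , i * k) ∷ (i , i * j * k) ∷ P i j k

Collineation : (I₀ → I₀) → Set
Collineation σ = Bijective _≡_ _≡_ σ × (∀ i j → σ (i * j) ≡ σ i * σ j)

image : (I₀ → I₀) → Rel₂ → Rel₂
image σ A a b = ∃[ i ] ∃[ j ] (σ i ≡ a × σ j ≡ b × (A ∋₂ i , j))

P121 : Rel₂
P121 = Gen (fromList (P (# 1) (# 2) (# 1)))

-- A nice set T is closed under the rule {i,j}, {i*j,k} ∈ T ⇒ P_{i,j,k} ⊆ T, so
-- its trace on X can be found by deciding the 21 pairs of X one at a time:
-- after a positive decision the current set is closed under the rule, and a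
-- branch dies as soon as this closure contains a pair decided negatively.
-- Started from the closure ⟨P_{1,2,1}⟩, this search has twelve leaves, and each
-- is carried onto one of the nine listed sets by the identity or by the
-- collineation (3 4)(6 7), both of which fix ⟨P_{1,2,1}⟩. The search and these
-- comparisons are carried out by evaluation; what is proved is their soundness.
module Submission where

open import Defs
open import Data.Bool using (Bool; true; false)
import Data.Bool as Bool
open import Data.Empty using (⊥-elim)
open import Data.Fin using (zero; suc; _≟_; _<_; #_)
open import Data.Fin.Properties using (all?; <-cmp; _<?_)
open import Data.List using (List; []; _∷_; _++_; concatMap; filter; allFin; cartesianProduct)
open import Data.List.Membership.Propositional using (_∈_)
open import Data.List.Membership.Propositional.Properties
  using (∈-++⁺ˡ; ∈-++⁺ʳ; ∈-filter⁺; ∈-cartesianProduct⁺; ∈-allFin)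
open import Data.List.Relation.Unary.All as All using (All; []; _∷_)
open import Data.List.Relation.Unary.All.Properties
  using (++⁺; concat⁺; map⁺; all-filter; All¬⇒¬Any)
open import Data.List.Relation.Unary.Any using (Any; here; any?; satisfied)
open import Data.Nat using (ℕ; zero; suc)
open import Data.Product using (Σ; ∃-syntax; _×_; _,_; proj₁; proj₂)
open import Data.Product.Properties using (≡-dec)
open import Data.Sum using (_⊎_; inj₁; inj₂)
import Data.Sum as Sum
open import Data.Vec using (Vec; []; _∷_; lookup; replicate; updateAt)
open import Data.Vec.Properties using (lookup∘updateAt; lookup∘updateAt′; lookup-replicate)
open import Function using (id)
open import Function.Consequences.Propositional
  using (inverseᵇ⇒bijective; strictlyInverseˡ⇒inverseˡ; strictlyInverseʳ⇒inverseʳ)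
open import Relation.Binary.Definitions using (Decidable; tri<; tri≈; tri>)
open import Relation.Binary.PropositionalEquality using (_≡_; _≢_; refl; sym; trans; cong; subst₂)
open import Relation.Nullary using (¬_; Dec; yes; no; does)
open import Relation.Nullary.Decidable using (map′; _×-dec_; _⊎-dec_; _→-dec_; ¬?)
import Relation.Unary as U

Pair : Set
Pair = I₀ × I₀

_≟ₚ_ : (p q : Pair) → Dec (p ≡ q)
_≟ₚ_ = ≡-dec _≟_ _≟_

_∋ₚ_ : Rel₂ → Pair → Set
R ∋ₚ p = R ∋₂ proj₁ p , proj₂ p

Gen-nice : ∀ S → Nice (Gen S)
Gen-nice S i j k Gij Gk = All.tabulate (λ m → inj₁ (close (oriented Gij) (oriented Gk) m))
  where
  oriented : ∀ {a b} → Gen S ∋₂ a , b → Gen S a b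
  oriented (inj₁ g) = g
  oriented (inj₂ g) = swap g

Gen-least : ∀ {S Q} → Nice Q → S ⊆₂ Q → Gen S ⊆₂ Q
Gen-least {S} {Q} nice S⊆Q i j (inj₁ g) = sound g
  where
  sound : ∀ {a b} → Gen S a b → Q ∋₂ a , b
  sound (base s) = S⊆Q _ _ s
  sound (swap g) = Sum.swap (sound g)
  sound (close g h m) = All.lookup (nice _ _ _ (sound g) (sound h)) m
Gen-least nice S⊆Q i j (inj₂ g) = Sum.swap (Gen-least nice S⊆Q j i (inj₁ g))

≐-sym : ∀ {A B} → A ≐ B → B ≐ A
≐-sym A≐B i j = proj₂ (A≐B i j) , proj₁ (A≐B i j)

≐-trans : ∀ {A B C} → A ≐ B → B ≐ C → A ≐ C
≐-trans A≐B B≐C i j = (λ a → proj₁ (B≐C i j) (proj₁ (A≐B i j) a))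
                    , (λ c → proj₂ (A≐B i j) (proj₂ (B≐C i j) c))

⊆₂-antisym : ∀ {A B} → A ⊆₂ B → B ⊆₂ A → A ≐ B
⊆₂-antisym A⊆B B⊆A i j = A⊆B i j , B⊆A i j

image-mono : ∀ σ {A B} → A ⊆₂ B → image σ A ⊆₂ image σ B
image-mono σ {A} {B} A⊆B a b = Sum.map shift shift
  where
  shift : ∀ {x y} → image σ A x y → image σ B x y
  shift (i , j , σi , σj , m) = i , j , σi , σj , A⊆B i j m

image-cong : ∀ σ {A B} → A ≐ B → image σ A ≐ image σ B
image-cong σ A≐B =
  ⊆₂-antisym (image-mono σ (λ i j → proj₁ (A≐B i j))) (image-mono σ (λ i j → proj₂ (A≐B i j)))

∩₂-agree : ∀ {A B C} → B ⊆₂ A → (A ∩₂ C) ⊆₂ B → (A ∩₂ C) ≐ (B ∩₂ C)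
∩₂-agree {A} {B} {C} B⊆A A∩C⊆B = ⊆₂-antisym to from
  where
  to : (A ∩₂ C) ⊆₂ (B ∩₂ C)
  to i j (inj₁ (a , c)) = inj₁ (A∩C⊆B i j (inj₁ (a , c)) , c)
  to i j (inj₂ (a , c)) = inj₂ (A∩C⊆B j i (inj₁ (a , c)) , c)
  from : (B ∩₂ C) ⊆₂ (A ∩₂ C)
  from i j (inj₁ (b , c)) = inj₁ (B⊆A i j b , c)
  from i j (inj₂ (b , c)) = inj₂ (B⊆A j i b , c)

-- Used instead of toWitness: the type checker evaluates d far more cheaply
-- when checking refl : does d ≡ true than when checking tt : True d.
from-does : ∀ {A : Set} (d : Dec A) → does d ≡ true → A
from-does (yes a) _ = a
from-does (no _) ()

∋₂? : ∀ {R} → Decidable R → ∀ i j → Dec (R ∋₂ i , j)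
∋₂? R? i j = R? i j ⊎-dec R? j i

⊆₂? : ∀ {A B} → Decidable A → Decidable B → Dec (A ⊆₂ B)
⊆₂? A? B? = all? λ i → all? λ j → ∋₂? A? i j →-dec ∋₂? B? i j

≐? : ∀ {A B} → Decidable A → Decidable B → Dec (A ≐ B)
≐? A? B? = all? λ i → all? λ j →
  (∋₂? A? i j →-dec ∋₂? B? i j) ×-dec (∋₂? B? i j →-dec ∋₂? A? i j)

nice? : ∀ {R} → Decidable R → Dec (Nice R)
nice? R? = all? λ i → all? λ j → all? λ k →
  ∋₂? R? i j →-dec ∋₂? R? (i * j) k →-dec All.all? (λ p → ∋₂? R? (proj₁ p) (proj₂ p)) (P i j k)

∩₂? : ∀ {A B} → Decidable A → Decidable B → Decidable (A ∩₂ B)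
∩₂? A? B? i j = ∋₂? A? i j ×-dec ∋₂? B? i j

image? : ∀ {σ A} → (∀ x → σ (σ x) ≡ x) → Decidable A → Decidable (image σ A)
image? {σ} {A} involutive A? a b =
  map′ (λ m → σ a , σ b , involutive a , involutive b , m) unshift (∋₂? A? (σ a) (σ b))
  where
  unshift : image σ A a b → A ∋₂ σ a , σ b
  unshift (i , j , refl , refl , m) =
    subst₂ (λ x y → A ∋₂ x , y) (sym (involutive i)) (sym (involutive j)) m

fromList? : ∀ l → Decidable (fromList l)
fromList? l i j = any? ((i , j) ≟ₚ_) l

X? : Decidable XSet
X? i j = ¬? (i ≟ # 0) ×-dec ¬? (j ≟ # 0) ×-dec ¬? (i ≟ j)

Xin? : ∀ ℓ → Decidable (Xin ℓ)
Xin? ℓ i j = X? i j ×-dec any? (i ≟_) ℓ ×-dec any? (j ≟_) ℓ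

XminusXC? : ∀ ℓ → Decidable (XminusXC ℓ)
XminusXC? ℓ i j = X? i j ×-dec ¬? (¬? (any? (i ≟_) ℓ) ×-dec ¬? (any? (j ≟_) ℓ))

X₁? : Decidable X₁
X₁? i j = X? i j ×-dec (i ≟ # 1)

-- An 8 × 8 Boolean table, so that the search below, run by the type checker,
-- tests membership by a lookup rather than by scanning a list.
PairSet : Set
PairSet = Vec (Vec Bool 8) 8

_∋ᵇ_ : PairSet → Pair → Bool
S ∋ᵇ p = lookup (lookup S (proj₁ p)) (proj₂ p)

⟦_⟧ : PairSet → Rel₂
⟦ S ⟧ i j = S ∋ᵇ (i , j) ≡ true

⟦_⟧? : ∀ S → Decidable ⟦ S ⟧
⟦ S ⟧? i j = S ∋ᵇ (i , j) Bool.≟ true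

_⊆ₜ_ : PairSet → PairSet → Set
S ⊆ₜ S′ = ∀ {q} → S ∋ᵇ q ≡ true → S′ ∋ᵇ q ≡ true

_⊆ᴿ_ : PairSet → Rel₂ → Set
S ⊆ᴿ R = ∀ {q} → S ∋ᵇ q ≡ true → R ∋ₚ q

⊆ᴿ⇒⊆₂ : ∀ {S R} → S ⊆ᴿ R → ⟦ S ⟧ ⊆₂ R
⊆ᴿ⇒⊆₂ S⊆R i j (inj₁ m) = S⊆R m
⊆ᴿ⇒⊆₂ S⊆R i j (inj₂ m) = Sum.swap (S⊆R m)

∅ : PairSet
∅ = replicate 8 (replicate 8 false)

∅-lookup : ∀ q → ∅ ∋ᵇ q ≡ false
∅-lookup (i , j) = trans (cong (λ row → lookup row j) (lookup-replicate i _)) (lookup-replicate j false)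

∅⊆ᴿ : ∀ {R} → ∅ ⊆ᴿ R
∅⊆ᴿ {q = q} m with () ← trans (sym (∅-lookup q)) m

set : Pair → PairSet → PairSet
set (a , b) S = updateAt S a (λ row → updateAt row b (λ _ → true))

set-∋-same : ∀ p S → set p S ∋ᵇ p ≡ true
set-∋-same (a , b) S =
  trans (cong (λ row → lookup row b) (lookup∘updateAt a S)) (lookup∘updateAt b (lookup S a))

set-∋-other : ∀ {p q} S → q ≢ p → set p S ∋ᵇ q ≡ S ∋ᵇ q
set-∋-other {a , b} {i , j} S q≢p with i ≟ a
... | no i≢a = cong (λ row → lookup row j) (lookup∘updateAt′ i a i≢a S)
... | yes refl = trans (cong (λ row → lookup row j) (lookup∘updateAt i S))
                       (lookup∘updateAt′ j b (λ j≡b → q≢p (cong (i ,_) j≡b)) (lookup S i))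

set-mono : ∀ p S → S ⊆ₜ set p S
set-mono p S {q} m with q ≟ₚ p
... | yes refl = set-∋-same p S
... | no q≢p = trans (set-∋-other S q≢p) m

set⁻ : ∀ p S {q} → set p S ∋ᵇ q ≡ true → q ≡ p ⊎ S ∋ᵇ q ≡ true
set⁻ p S {q} m with q ≟ₚ p
... | yes q≡p = inj₁ q≡p
... | no q≢p = inj₂ (trans (sym (set-∋-other S q≢p)) m)

insert : Pair → PairSet → PairSet
insert (a , b) S = set (a , b) (set (b , a) S)

insert-∋ : ∀ p S → insert p S ∋ᵇ p ≡ true
insert-∋ (a , b) S = set-∋-same (a , b) (set (b , a) S)

insert-mono : ∀ p S → S ⊆ₜ insert p S
insert-mono (a , b) S m = set-mono (a , b) (set (b , a) S) (set-mono (b , a) S m)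

insert-sound : ∀ {R p S} → R ∋ₚ p → S ⊆ᴿ R → insert p S ⊆ᴿ R
insert-sound {p = a , b} {S} Rab S⊆R {q} m with set⁻ (a , b) (set (b , a) S) {q} m
... | inj₁ refl = Rab
... | inj₂ m′ with set⁻ (b , a) S {q} m′
...   | inj₁ refl = Sum.swap Rab
...   | inj₂ m″ = S⊆R m″

-- Closure under the rule of nice sets

Instance : Set
Instance = I₀ × I₀ × I₀

Fires : PairSet → Instance → Set
Fires S (i , j , k) = S ∋ᵇ (i , j) ≡ true × S ∋ᵇ (i * j , k) ≡ true

fires? : ∀ S → U.Decidable (Fires S)
fires? S (i , j , k) = (S ∋ᵇ (i , j) Bool.≟ true) ×-dec (S ∋ᵇ (i * j , k) Bool.≟ true)

conclusion : Instance → List Pair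
conclusion (i , j , k) = P i j k

-- The instances with q = {i, j} or q = {i * j, k} among their premises; in the
-- second case i * j = a determines j = i * a.
instancesWith : Pair → List Instance
instancesWith (a , b) = concatMap (λ k → (a , b , k) ∷ (b , a , k) ∷ []) (allFin 8)
                     ++ concatMap (λ i → (i , i * a , b) ∷ (i , i * b , a) ∷ []) (allFin 8)

consequences : Pair → PairSet → List Pair
consequences q S = concatMap conclusion (filter (fires? S) (instancesWith q))

consequences-sound : ∀ {R} → Nice R → ∀ q {S} → S ⊆ᴿ R → All (R ∋ₚ_) (consequences q S)
consequences-sound {R} nice q {S} S⊆R =
  concat⁺ (map⁺ (All.map conclusion-sound (all-filter (fires? S) (instancesWith q))))
  where
  conclusion-sound : ∀ {t} → Fires S t → All (R ∋ₚ_) (conclusion t)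
  conclusion-sound {i , j , k} (ij , ijk) = nice i j k (S⊆R ij) (S⊆R ijk)

saturate : ℕ → List Pair → PairSet → PairSet
saturate zero todo S = S
saturate (suc n) [] S = S
saturate (suc n) (q ∷ todo) S with S ∋ᵇ q
... | true = saturate n todo S
... | false = grow (insert q S)
  where
  -- binding the enlarged table once lets the evaluator share it between its two uses
  grow : PairSet → PairSet
  grow S′ = saturate n (consequences q S′ ++ todo) S′

saturate-sound : ∀ {R} → Nice R → ∀ n {todo S} →
                 All (R ∋ₚ_) todo → S ⊆ᴿ R → saturate n todo S ⊆ᴿ R
saturate-sound nice zero todo⊆R S⊆R = S⊆R
saturate-sound nice (suc n) [] S⊆R = S⊆R
saturate-sound nice (suc n) {q ∷ todo} {S} (Rq ∷ todo⊆R) S⊆R with S ∋ᵇ q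
... | true = saturate-sound nice n todo⊆R S⊆R
... | false =
  saturate-sound nice n (++⁺ (consequences-sound nice q {insert q S} S′⊆R) todo⊆R) S′⊆R
  where
  S′⊆R : insert q S ⊆ᴿ _
  S′⊆R = insert-sound {p = q} {S} Rq S⊆R

saturate-mono : ∀ n todo S → S ⊆ₜ saturate n todo S
saturate-mono zero todo S m = m
saturate-mono (suc n) [] S m = m
saturate-mono (suc n) (q ∷ todo) S m with S ∋ᵇ q
... | true = saturate-mono n todo S m
... | false = saturate-mono n _ (insert q S) (insert-mono q S m)

saturate-∋ : ∀ n q todo S → saturate (suc n) (q ∷ todo) S ∋ᵇ q ≡ true
saturate-∋ n q todo S with S ∋ᵇ q in Sq
... | true = saturate-mono n todo S Sq
... | false = saturate-mono n _ (insert q S) (insert-∋ q S)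

-- Fuel only bounds the running time: saturate is sound for any fuel, and this
-- is ample for every closure computed below.
fuel : ℕ
fuel = 100000

search : PairSet → List Pair → List Pair → List PairSet
searchIfDisjoint : PairSet → List Pair → List Pair → List PairSet

search F E [] = F ∷ []
search F E (p ∷ ps) with F ∋ᵇ p
... | true = search F E ps
... | false = search F (p ∷ E) ps ++ searchIfDisjoint (saturate (suc fuel) (p ∷ []) F) E ps

searchIfDisjoint F E ps with any? (λ e → F ∋ᵇ e Bool.≟ true) E
... | yes _ = []
... | no _ = search F E ps

Leaf : Rel₂ → PairSet → List Pair → PairSet → Set
Leaf R F ps L = L ⊆ᴿ R × F ⊆ₜ L × All (λ p → R ∋ₚ p → L ∋ᵇ p ≡ true) ps

search-complete : ∀ {R} → Decidable R → Nice R → ∀ {F E} ps →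
                  F ⊆ᴿ R → All (λ e → ¬ R ∋ₚ e) E → ∃[ L ] L ∈ search F E ps × Leaf R F ps L
searchIfDisjoint-complete : ∀ {R} → Decidable R → Nice R → ∀ {F E} ps →
                            F ⊆ᴿ R → All (λ e → ¬ R ∋ₚ e) E →
                            ∃[ L ] L ∈ searchIfDisjoint F E ps × Leaf R F ps L

search-complete R? nice {F} [] F⊆R E∉R = F , here refl , F⊆R , id , []
search-complete R? nice {F} {E} (p ∷ ps) F⊆R E∉R with F ∋ᵇ p in Fp
... | true =
  let L , L∈ , L⊆R , F⊆L , decided = search-complete R? nice ps F⊆R E∉R
  in L , L∈ , L⊆R , F⊆L , (λ _ → F⊆L Fp) ∷ decided
... | false with ∋₂? R? (proj₁ p) (proj₂ p)
...   | no ¬Rp =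
  let L , L∈ , L⊆R , F⊆L , decided = search-complete R? nice ps F⊆R (¬Rp ∷ E∉R)
  in L , ∈-++⁺ˡ L∈ , L⊆R , F⊆L , (λ Rp → ⊥-elim (¬Rp Rp)) ∷ decided
...   | yes Rp =
  let F′ = saturate (suc fuel) (p ∷ []) F
      F′⊆R = saturate-sound nice (suc fuel) {S = F} (Rp ∷ []) F⊆R
      L , L∈ , L⊆R , F′⊆L , decided = searchIfDisjoint-complete R? nice {F′} ps F′⊆R E∉R
  in L , ∈-++⁺ʳ (search F (p ∷ E) ps) L∈ , L⊆R
       , (λ m → F′⊆L (saturate-mono (suc fuel) (p ∷ []) F m))
       , (λ _ → F′⊆L (saturate-∋ fuel p [] F)) ∷ decided

searchIfDisjoint-complete R? nice {F} {E} ps F⊆R E∉R with any? (λ e → F ∋ᵇ e Bool.≟ true) E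
... | yes F∩E = ⊥-elim (All¬⇒¬Any (All.map (λ ¬Re Fe → ¬Re (F⊆R Fe)) E∉R) F∩E)
... | no _ = search-complete R? nice ps F⊆R E∉R

Ordered : Pair → Set
Ordered (i , j) = i ≢ # 0 × i < j

ordered? : U.Decidable Ordered
ordered? (i , j) = ¬? (i ≟ # 0) ×-dec (i <? j)

allPairs : List Pair
allPairs = cartesianProduct (allFin 8) (allFin 8)

∈-allPairs : ∀ i j → (i , j) ∈ allPairs
∈-allPairs i j = ∈-cartesianProduct⁺ (∈-allFin i) (∈-allFin j)

Xpairs : List Pair
Xpairs = filter ordered? allPairs

Xpairs-cover : ∀ {i j} → XSet i j → (i , j) ∈ Xpairs ⊎ (j , i) ∈ Xpairs
Xpairs-cover {i} {j} (i≢0 , j≢0 , i≢j) with <-cmp i j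
... | tri< i<j _ _ = inj₁ (∈-filter⁺ ordered? (∈-allPairs i j) (i≢0 , i<j))
... | tri≈ _ i≡j _ = ⊥-elim (i≢j i≡j)
... | tri> _ _ j<i = inj₂ (∈-filter⁺ ordered? (∈-allPairs j i) (j≢0 , j<i))

X-part-agrees : ∀ {R L} → L ⊆ᴿ R → All (λ p → R ∋ₚ p → L ∋ᵇ p ≡ true) Xpairs →
                (R ∩₂ XSet) ≐ (⟦ L ⟧ ∩₂ XSet)
X-part-agrees {R} {L} L⊆R decided = ∩₂-agree (⊆ᴿ⇒⊆₂ {L} L⊆R) R∩X⊆L
  where
  via-Xpairs : ∀ {i j} → R ∋₂ i , j → (i , j) ∈ Xpairs ⊎ (j , i) ∈ Xpairs → ⟦ L ⟧ ∋₂ i , j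
  via-Xpairs Rij (inj₁ ij∈) = inj₁ (All.lookup decided ij∈ Rij)
  via-Xpairs Rij (inj₂ ji∈) = inj₂ (All.lookup decided ji∈ (Sum.swap Rij))

  in-X : ∀ {i j} → R ∋₂ i , j → XSet ∋₂ i , j → ⟦ L ⟧ ∋₂ i , j
  in-X Rij (inj₁ Xij) = via-Xpairs Rij (Xpairs-cover Xij)
  in-X Rij (inj₂ Xji) = via-Xpairs Rij (Sum.swap (Xpairs-cover Xji))

  R∩X⊆L : (R ∩₂ XSet) ⊆₂ ⟦ L ⟧
  R∩X⊆L i j (inj₁ (Rij , Xij)) = in-X Rij Xij
  R∩X⊆L i j (inj₂ (Rji , Xji)) = Sum.swap (in-X Rji Xji)

-- Symmetries of ⟨P_{1,2,1}⟩

P121-generators : List Pair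
P121-generators = P (# 1) (# 2) (# 1)

P121-table : PairSet
P121-table = saturate fuel P121-generators ∅

P121-table-sound : ∀ {R} → Nice R → P121 ⊆₂ R → P121-table ⊆ᴿ R
P121-table-sound {R} nice P121⊆R =
  saturate-sound nice fuel {S = ∅} (All.tabulate (λ m → P121⊆R _ _ (inj₁ (base (inj₁ m)))))
                 (∅⊆ᴿ {R})

P121≐table : P121 ≐ ⟦ P121-table ⟧
P121≐table = ⊆₂-antisym
  (Gen-least (from-does (nice? ⟦ P121-table ⟧?) refl)
             (from-does (⊆₂? (fromList? P121-generators) ⟦ P121-table ⟧?) refl))
  (⊆ᴿ⇒⊆₂ {P121-table} (P121-table-sound (Gen-nice _) (λ _ _ → id)))

involutive? : (σ : I₀ → I₀) → Dec (∀ x → σ (σ x) ≡ x)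
involutive? σ = all? λ x → σ (σ x) ≟ x

homomorphic? : (σ : I₀ → I₀) → Dec (∀ i j → σ (i * j) ≡ σ i * σ j)
homomorphic? σ = all? λ i → all? λ j → σ (i * j) ≟ σ i * σ j

fixes-table? : (σ : I₀ → I₀) → (∀ x → σ (σ x) ≡ x) →
               Dec (image σ ⟦ P121-table ⟧ ≐ ⟦ P121-table ⟧)
fixes-table? σ involutive = ≐? (image? {σ} involutive ⟦ P121-table ⟧?) ⟦ P121-table ⟧?

record Symmetry : Set where
  field
    σ : I₀ → I₀
    involutive : ∀ x → σ (σ x) ≡ x
    homomorphic : ∀ i j → σ (i * j) ≡ σ i * σ j
    fixes-table : image σ ⟦ P121-table ⟧ ≐ ⟦ P121-table ⟧

  collineation : Collineation σ
  collineation =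
    inverseᵇ⇒bijective (strictlyInverseˡ⇒inverseˡ σ involutive , strictlyInverseʳ⇒inverseʳ σ involutive)
    , homomorphic

  stabilises : image σ P121 ≐ P121
  stabilises = ≐-trans (image-cong σ P121≐table) (≐-trans fixes-table (≐-sym P121≐table))

involution : (σ : I₀ → I₀) (inv : does (involutive? σ) ≡ true) → does (homomorphic? σ) ≡ true →
             does (fixes-table? σ (from-does (involutive? σ) inv)) ≡ true → Symmetry
involution σ inv hom fix = record
  { σ = σ
  ; involutive = from-does (involutive? σ) inv
  ; homomorphic = from-does (homomorphic? σ) hom
  ; fixes-table = from-does (fixes-table? σ (from-does (involutive? σ) inv)) fix
  }

swap-34-67 : I₀ → I₀
swap-34-67 = lookup (# 0 ∷ # 1 ∷ # 2 ∷ # 4 ∷ # 3 ∷ # 5 ∷ # 7 ∷ # 6 ∷ [])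

symmetries : List Symmetry
symmetries = involution id refl refl refl ∷ involution swap-34-67 refl refl refl ∷ []

Listed : Rel₂ → Set
Listed A =
    A ≐ fromList ((# 1 , # 2) ∷ (# 1 , # 5) ∷ [])
  ⊎ A ≐ Xin (lineOf (# 1) (# 2))
  ⊎ A ≐ fromList ((# 1 , # 2) ∷ (# 1 , # 3) ∷ (# 1 , # 5) ∷ (# 1 , # 6) ∷ [])
  ⊎ A ≐ X₁
  ⊎ A ≐ fromList (Tgen (# 1) (# 2) (# 3))
  ⊎ A ≐ fromList (Tgen (# 1) (# 3) (# 4))
  ⊎ A ≐ XminusXC (lineOf (# 1) (# 2))
  ⊎ A ≐ XminusXC (lineOf (# 1) (# 3))
  ⊎ A ≐ XSet

listed? : ∀ {A} → Decidable A → Dec (Listed A)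
listed? A? =
        ≐? A? (fromList? _)
  ⊎-dec ≐? A? (Xin? _)
  ⊎-dec ≐? A? (fromList? _)
  ⊎-dec ≐? A? X₁?
  ⊎-dec ≐? A? (fromList? _)
  ⊎-dec ≐? A? (fromList? _)
  ⊎-dec ≐? A? (XminusXC? _)
  ⊎-dec ≐? A? (XminusXC? _)
  ⊎-dec ≐? A? X?

Listed-resp : ∀ {A B} → A ≐ B → Listed B → Listed A
Listed-resp {A} {B} A≐B =
  Sum.map via (Sum.map via (Sum.map via (Sum.map via
    (Sum.map via (Sum.map via (Sum.map via (Sum.map via via)))))))
  where
  via : ∀ {C} → B ≐ C → A ≐ C
  via = ≐-trans A≐B

Classified : PairSet → Set
Classified L = Any (λ s → Listed (image (Symmetry.σ s) (⟦ L ⟧ ∩₂ XSet))) symmetries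

classified? : U.Decidable Classified
classified? L = any? (λ s → listed? (image? (Symmetry.involutive s) (∩₂? ⟦ L ⟧? X?))) symmetries

leaves-classified : All Classified (search P121-table [] Xpairs)
leaves-classified = from-does (All.all? classified? (search P121-table [] Xpairs)) refl

classify : ∀ {R} → Decidable R → Nice R → P121 ⊆₂ R → ∃[ s ] Listed (image (Symmetry.σ s) (R ∩₂ XSet))
classify {R} R? nice P121⊆R =
  let L , L∈leaves , L⊆R , _ , decided =
        search-complete R? nice {P121-table} Xpairs (P121-table-sound nice P121⊆R) []
      s , listed = satisfied (All.lookup leaves-classified L∈leaves)
      X-parts≐ = X-part-agrees {L = L} L⊆R decided
  -- left to unification, the two sets below take the type checker minutes to find
  in s , Listed-resp (image-cong (Symmetry.σ s) {R ∩₂ XSet} {⟦ L ⟧ ∩₂ XSet} X-parts≐) listed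

corollary5p7 : (T : I₀ → I₀ → Bool) → Nice (boolSet T) → P121 ⊆₂ boolSet T →
    Σ (I₀ → I₀) λ σ → Collineation σ × image σ P121 ≐ P121 ×
      ( image σ (boolSet T ∩₂ XSet) ≐ fromList ((# 1 , # 2) ∷ (# 1 , # 5) ∷ [])
      ⊎ image σ (boolSet T ∩₂ XSet) ≐ Xin (lineOf (# 1) (# 2))
      ⊎ image σ (boolSet T ∩₂ XSet) ≐ fromList ((# 1 , # 2) ∷ (# 1 , # 3) ∷ (# 1 , # 5) ∷ (# 1 , # 6) ∷ [])
      ⊎ image σ (boolSet T ∩₂ XSet) ≐ X₁
      ⊎ image σ (boolSet T ∩₂ XSet) ≐ fromList (Tgen (# 1) (# 2) (# 3))
      ⊎ image σ (boolSet T ∩₂ XSet) ≐ fromList (Tgen (# 1) (# 3) (# 4))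
      ⊎ image σ (boolSet T ∩₂ XSet) ≐ XminusXC (lineOf (# 1) (# 2))
      ⊎ image σ (boolSet T ∩₂ XSet) ≐ XminusXC (lineOf (# 1) (# 3))
      ⊎ image σ (boolSet T ∩₂ XSet) ≐ XSet )
corollary5p7 T nice P121⊆T =
  let s , listed = classify (λ i j → T i j Bool.≟ true) nice P121⊆T
      open Symmetry s
  in σ , collineation , stabilises , listed
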